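{- An MR geometry with exactly six green points has at most $13$ points.
   Context: A finite linear space consists of a finite set of points and a set of lines (sets of points) such that any two distinct points lie on exactly one common line, every line has at least two points, and not all points are on one line. An MR geometry is a finite linear space with each point coloured red or green such that every line contains at least one red and at least one green point. -}

module Defs where

open import Data.Nat using (ℕ; _≤_)
open import Data.Fin using (Fin)
open import Data.Fin.Subset using (Subset; _∈_; _∉_; ∣_∣)
open import Data.Bool using (Bool; true; false)
open import Data.Vec using (tabulate)
open import Data.Product using (Σ; _×_; ∃-syntax)
open import Relation.Binary.PropositionalEquality using (_≡_; _≢_)
open import Relation.Nullary using (¬_)

record IsLinearSpace (n m : ℕ) (L : Fin m → Subset n) : Set where
  field
    line-size : ∀ (l : Fin m) → 2 ≤ ∣ L l ∣
    join : ∀ (p q : Fin n) → p ≢ q → ∃[ l ] (p ∈ L l × q ∈ L l)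
    join-unique : ∀ (p q : Fin n) → p ≢ q → ∀ (l l′ : Fin m) →
                  p ∈ L l → q ∈ L l → p ∈ L l′ → q ∈ L l′ → l ≡ l′
    nontrivial : ∀ (l : Fin m) → ∃[ p ] (p ∉ L l)

Red Green : Bool
Red = true
Green = false

record IsMRGeometry (n m : ℕ) (L : Fin m → Subset n) (c : Fin n → Bool) : Set where
  field
    linearSpace : IsLinearSpace n m L
    has-red   : ∀ (l : Fin m) → ∃[ p ] (p ∈ L l × c p ≡ Red)
    has-green : ∀ (l : Fin m) → ∃[ p ] (p ∈ L l × c p ≡ Green)

greenPoints : ∀ {n} → (Fin n → Bool) → Subset n
greenPoints c = tabulate λ p → isGreen (c p)
  where
  isGreen : Bool → Bool
  isGreen true = false
  isGreen false = true

{-# OPTIONS --safe #-}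
module Submission where

-- Fix a line l; let A be its red points, B its green points and G′ the green points off l.
-- From a red point y off l the lines yx (x ∈ A) are distinct and each carries a green point of
-- G′ (a fan), so |A| ≤ |G′|.  Choosing y on the line through h ∈ G′ and a green point of l makes
-- the fan avoid h, so |A| < |G′|, and every line has at most |A| + |B| ≤ 5 points.
-- On a five-point line |G′| = |A| + 1, so no fan can avoid two greens of G′.  Call g ∈ G′ alone at
-- x ∈ A when the line xg contains no other green.  Then at least two greens are alone at each x,
-- every g is alone somewhere, and any two greens of G′ span a line through a point of A.  This
-- forces |A| = 4, then makes every g ∈ G′ crowded (not alone) at exactly two points of A and every
-- x ∈ A crowded for 0 or 3 greens; counting crowded pairs both ways gives 3 ∣ 2·5.
-- Hence lines have at most four points and n ≤ 1 + 3·deg z for every point z.  If n ≥ 14, every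
-- red point lies on at least five lines, so on at most one line with two greens and on none with
-- three.  Then each of the six greens is joined to the five others through five distinct red
-- points, while each red point serves at most two greens: 30 ≤ 2·#red.  But deg z ≤ 6 for red z
-- gives n ≤ 19, i.e. #red ≤ 13.

open import Defs
open import Algebra.Properties.CommutativeMonoid.Sum as Sum using ()
open import Data.Bool using (Bool; true; false)
open import Data.Bool.Properties as Bool using ()
open import Data.Empty using (⊥; ⊥-elim)
open import Data.Fin using (Fin; zero; suc)
open import Data.Fin.Properties using (_≟_; suc-injective; 0≢1+n; any?; all?)
open import Data.Fin.Subset using (Subset; _∈_; _∉_; ∣_∣)
open import Data.Fin.Subset.Properties using (_∈?_)
open import Data.Nat using (ℕ; zero; suc; _+_; _*_; _≤_; _<_; _≤?_; z≤n; s≤s)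
open import Data.Nat.Divisibility using (_∣_; _∣?_; ∣m∣n⇒∣m+n; _∣0; ∣-reflexive)
open import Data.Nat.Properties as ℕ hiding (_≟_; suc-injective; 0≢1+n)
open import Data.Product using (∃; ∃-syntax; _×_; _,_; proj₁; proj₂; swap)
open import Data.Sum using (_⊎_; inj₁; inj₂; [_,_]′)
open import Function using (_∘_; id; flip)
open import Level using (Level; 0ℓ)
open import Relation.Binary.PropositionalEquality
open import Relation.Nullary using (¬_; Dec; yes; no; _×-dec_; _→-dec_; ¬?; contradiction)
open import Relation.Nullary.Decidable using (from-no)
open import Relation.Unary using (Pred; Decidable; _⊆_; _∩_; ∁; U)
open import Relation.Unary.Properties using (_∩?_; ∁?; U?)

open Sum +-0-commutativeMonoid using (sum; ∑-comm; sum-cong-≗)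

indicator : ∀ {a} {A : Set a} → Dec A → ℕ
indicator (yes _) = 1
indicator (no _)  = 0

count : ∀ {k p} {P : Pred (Fin k) p} → Decidable P → ℕ
count P? = sum (λ x → indicator (P? x))

private
  variable
    p q : Level
    k : ℕ
    P : Pred (Fin k) p
    Q : Pred (Fin k) q

∑-mono-≤ : {f g : Fin k → ℕ} → (∀ x → f x ≤ g x) → sum f ≤ sum g
∑-mono-≤ {zero}  f≤g = z≤n
∑-mono-≤ {suc k} f≤g = +-mono-≤ (f≤g zero) (∑-mono-≤ (f≤g ∘ suc))

∑-mono-< : {f g : Fin k → ℕ} → (∀ x → f x ≤ g x) → (x : Fin k) → f x < g x → sum f < sum g
∑-mono-< f≤g zero    fx<gx = +-mono-<-≤ fx<gx (∑-mono-≤ (f≤g ∘ suc))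
∑-mono-< f≤g (suc x) fx<gx = +-mono-≤-< (f≤g zero) (∑-mono-< (f≤g ∘ suc) x fx<gx)

∑-* : (s : ℕ) (f : Fin k → ℕ) → sum (λ x → s * f x) ≡ s * sum f
∑-* {zero}  s f = sym (*-zeroʳ s)
∑-* {suc k} s f = trans (cong (s * f zero +_) (∑-* s (f ∘ suc))) (sym (*-distribˡ-+ s (f zero) _))

∣-∑ : {d : ℕ} (f : Fin k → ℕ) → (∀ x → d ∣ f x) → d ∣ sum f
∣-∑ {zero}  {d} f d∣f = d ∣0
∣-∑ {suc k}     f d∣f = ∣m∣n⇒∣m+n (d∣f zero) (∣-∑ (f ∘ suc) (d∣f ∘ suc))

count-all : count (U? {A = Fin k}) ≡ k
count-all {zero}  = refl
count-all {suc k} = cong suc (count-all {k})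

count-∅ : (P? : Decidable P) → (∀ x → ¬ P x) → count P? ≡ 0
count-∅ {zero}  P? ∄P = refl
count-∅ {suc k} P? ∄P with P? zero
... | yes Px = ⊥-elim (∄P zero Px)
... | no _   = count-∅ (P? ∘ suc) (∄P ∘ suc)

count-mono : (P? : Decidable P) (Q? : Decidable Q) → P ⊆ Q → count P? ≤ count Q?
count-mono {zero}  P? Q? P⊆Q = z≤n
count-mono {suc k} P? Q? P⊆Q with P? zero | Q? zero | count-mono (P? ∘ suc) (Q? ∘ suc) P⊆Q
... | yes _  | yes _  | ih = s≤s ih
... | yes Px | no ¬Qx | ih = ⊥-elim (¬Qx (P⊆Q Px))
... | no _   | yes _  | ih = m≤n⇒m≤1+n ih
... | no _   | no _   | ih = ih

count-cong : (P? : Decidable P) (Q? : Decidable Q) → P ⊆ Q → Q ⊆ P → count P? ≡ count Q?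
count-cong P? Q? P⊆Q Q⊆P = ≤-antisym (count-mono P? Q? P⊆Q) (count-mono Q? P? Q⊆P)

count-split : (P? : Decidable P) (Q? : Decidable Q) → count P? ≡ count (P? ∩? Q?) + count (P? ∩? ∁? Q?)
count-split {zero}  P? Q? = refl
count-split {suc k} P? Q? with P? zero | Q? zero | count-split (P? ∘ suc) (Q? ∘ suc)
... | yes _ | yes _ | ih = cong suc ih
... | yes _ | no _  | ih = trans (cong suc ih) (sym (+-suc _ _))
... | no _  | yes _ | ih = ih
... | no _  | no _  | ih = ih

count-singleton : (x : Fin k) → count (_≟ x) ≡ 1
count-singleton {suc k} zero    = cong suc (count-∅ {k} (λ y → suc y ≟ zero) (λ _ ()))
count-singleton {suc k} (suc x) = begin
  count (λ y → suc y ≟ suc x)  ≡⟨ count-cong (λ y → suc y ≟ suc x) (_≟ x) suc-injective (cong suc) ⟩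
  count (_≟ x)                 ≡⟨ count-singleton x ⟩
  1                            ∎
  where open ≡-Reasoning

count-remove : (P? : Decidable P) {x : Fin k} → P x → count P? ≡ suc (count (P? ∩? ∁? (_≟ x)))
count-remove P? {x} Px = begin
  count P?                     ≡⟨ count-split P? (_≟ x) ⟩
  count (P? ∩? (_≟ x)) + rest  ≡⟨ cong (_+ rest) (count-cong (P? ∩? (_≟ x)) (_≟ x) proj₂ λ { refl → Px , refl }) ⟩
  count (_≟ x) + rest          ≡⟨ cong (_+ rest) (count-singleton x) ⟩
  suc rest                     ∎
  where
  open ≡-Reasoning
  rest : ℕ
  rest = count (P? ∩? ∁? (_≟ x))

count-remove₂ : (P? : Decidable P) {x y : Fin k} → P x → P y → x ≢ y →
                count P? ≡ suc (suc (count (P? ∩? (∁? (_≟ x) ∩? ∁? (_≟ y)))))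
count-remove₂ P? {x} {y} Px Py x≢y = begin
  count P?                                            ≡⟨ count-remove P? Px ⟩
  suc (count (P? ∩? ∁? (_≟ x)))                       ≡⟨ cong suc (count-remove (P? ∩? ∁? (_≟ x)) (Py , x≢y ∘ sym)) ⟩
  suc (suc (count ((P? ∩? ∁? (_≟ x)) ∩? ∁? (_≟ y))))  ≡⟨ cong (λ c → suc (suc c)) (count-cong
                                                            ((P? ∩? ∁? (_≟ x)) ∩? ∁? (_≟ y)) (P? ∩? (∁? (_≟ x) ∩? ∁? (_≟ y)))
                                                            (λ ((Pz , z≢x) , z≢y) → Pz , z≢x , z≢y)
                                                            (λ (Pz , z≢x , z≢y) → (Pz , z≢x) , z≢y)) ⟩
  suc (suc (count (P? ∩? (∁? (_≟ x) ∩? ∁? (_≟ y)))))  ∎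
  where open ≡-Reasoning

0<count : (P? : Decidable P) {x : Fin k} → P x → 0 < count P?
0<count P? Px rewrite count-remove P? Px = s≤s z≤n

count-witness : (P? : Decidable P) → 0 < count P? → ∃ P
count-witness {zero}  P? ()
count-witness {suc k} P? 0<count with P? zero
... | yes Px = zero , Px
... | no _   = let x , Px = count-witness (P? ∘ suc) 0<count in suc x , Px

count-≥2 : (P? : Decidable P) {x y : Fin k} → P x → P y → x ≢ y → 2 ≤ count P?
count-≥2 P? {x} Px Py x≢y rewrite count-remove P? Px = s≤s (0<count (P? ∩? ∁? (_≟ x)) (Py , x≢y ∘ sym))

count-≥3 : (P? : Decidable P) {x y z : Fin k} → P x → P y → P z → x ≢ y → x ≢ z → y ≢ z → 3 ≤ count P?
count-≥3 P? {x} Px Py Pz x≢y x≢z y≢z rewrite count-remove P? Px =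
  s≤s (count-≥2 (P? ∩? ∁? (_≟ x)) (Py , x≢y ∘ sym) (Pz , x≢z ∘ sym) y≢z)

count≤1⇒≡ : (P? : Decidable P) → count P? ≤ 1 → {x y : Fin k} → P x → P y → x ≡ y
count≤1⇒≡ P? count≤1 {x} {y} Px Py with x ≟ y
... | yes x≡y = x≡y
... | no x≢y  = ⊥-elim (<-irrefl refl (≤-trans (count-≥2 P? Px Py x≢y) count≤1))

count≤2 : (P? : Decidable P) {x y : Fin k} → (∀ {z} → P z → z ≡ x ⊎ z ≡ y) → count P? ≤ 2
count≤2 P? {x} {y} P⊆xy = begin
  count P?                                        ≡⟨ count-split P? (_≟ x) ⟩
  count (P? ∩? (_≟ x)) + count (P? ∩? ∁? (_≟ x))  ≤⟨ +-mono-≤ (count-mono (P? ∩? (_≟ x)) (_≟ x) proj₂)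
                                                               (count-mono (P? ∩? ∁? (_≟ x)) (_≟ y)
                                                                  λ (Pz , z≢x) → [ flip contradiction z≢x , id ]′ (P⊆xy Pz)) ⟩
  count (_≟ x) + count (_≟ y)                     ≡⟨ cong₂ _+_ (count-singleton x) (count-singleton y) ⟩
  2                                               ∎
  where open ≤-Reasoning

count-injective : ∀ {k j p q} {P : Pred (Fin k) p} {Q : Pred (Fin j) q} (P? : Decidable P) (Q? : Decidable Q)
                  (f : ∀ x → P x → Fin j) → (∀ x Px → Q (f x Px)) →
                  (∀ x y Px Py → f x Px ≡ f y Py → x ≡ y) → count P? ≤ count Q?
count-injective {zero}  P? Q? f f∈Q f-inj = z≤n
count-injective {suc k} P? Q? f f∈Q f-inj with P? zero
... | no _ = count-injective (P? ∘ suc) Q? (f ∘ suc) (f∈Q ∘ suc)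
               (λ x y Px Py eq → suc-injective (f-inj (suc x) (suc y) Px Py eq))
... | yes P0 rewrite count-remove Q? (f∈Q zero P0) =
  s≤s (count-injective (P? ∘ suc) (Q? ∩? ∁? (_≟ f zero P0)) (f ∘ suc)
        (λ x Px → f∈Q (suc x) Px , λ eq → 0≢1+n (sym (f-inj (suc x) zero Px P0 eq)))
        (λ x y Px Py eq → suc-injective (f-inj (suc x) (suc y) Px Py eq)))

count-union : ∀ {k j p r} {P : Pred (Fin k) p} {R : Fin k → Fin j → Set r}
              (P? : Decidable P) (R? : ∀ x y → Dec (R x y)) →
              (∀ x → P x → ∃ (R x)) → count P? ≤ sum (λ y → count (λ x → R? x y))
count-union P? R? covered = begin
  count P?                          ≤⟨ ∑-mono-≤ indicator≤ ⟩
  sum (λ x → count (R? x))          ≡⟨ ∑-comm (λ x y → indicator (R? x y)) ⟩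
  sum (λ y → count (λ x → R? x y))  ∎
  where
  open ≤-Reasoning
  indicator≤ : ∀ x → indicator (P? x) ≤ count (R? x)
  indicator≤ x with P? x
  ... | no _   = z≤n
  ... | yes Px = 0<count (R? x) (proj₂ (covered x Px))

module LinearSpace {n m : ℕ} {L : Fin m → Subset n} (linearSpace : IsLinearSpace n m L) where

  open IsLinearSpace linearSpace

  Collinear : Fin n → Fin n → Fin n → Set
  Collinear x y z = ∃[ l ] (x ∈ L l × y ∈ L l × z ∈ L l)

  collinear? : ∀ x y z → Dec (Collinear x y z)
  collinear? x y z = any? λ l → x ∈? L l ×-dec y ∈? L l ×-dec z ∈? L l

  same-line : ∀ {p q l l′} → p ≢ q → p ∈ L l → q ∈ L l → p ∈ L l′ → q ∈ L l′ → l ≡ l′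
  same-line p≢q = join-unique _ _ p≢q _ _

  ∉⇒≢ : ∀ {y x l} → y ∉ L l → x ∈ L l → y ≢ x
  ∉⇒≢ y∉l x∈l refl = y∉l x∈l

  collinear⇒∈ : ∀ {p q r l} → p ≢ q → p ∈ L l → q ∈ L l → Collinear p q r → r ∈ L l
  collinear⇒∈ p≢q p∈l q∈l (l′ , p∈l′ , q∈l′ , r∈l′) =
    subst (λ l → _ ∈ L l) (same-line p≢q p∈l′ q∈l′ p∈l q∈l) r∈l′

  collinear-pivot : ∀ {p q a b} → p ≢ q → Collinear p a q → Collinear p b q → Collinear p a b
  collinear-pivot p≢q (l₁ , p∈l₁ , a∈l₁ , q∈l₁) (l₂ , p∈l₂ , b∈l₂ , q∈l₂) =
    l₁ , p∈l₁ , a∈l₁ , collinear⇒∈ p≢q p∈l₁ q∈l₁ (l₂ , p∈l₂ , q∈l₂ , b∈l₂)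

  meets-once : ∀ {y x x′ l} → y ∉ L l → x ∈ L l → x′ ∈ L l → Collinear y x x′ → x ≡ x′
  meets-once {x = x} {x′} y∉l x∈l x′∈l (l′ , y∈l′ , x∈l′ , x′∈l′) with x ≟ x′
  ... | yes x≡x′ = x≡x′
  ... | no x≢x′  = ⊥-elim (y∉l (collinear⇒∈ x≢x′ x∈l x′∈l (l′ , x∈l′ , x′∈l′ , y∈l′)))

  size : Fin m → ℕ
  size l = count (_∈? L l)

  degree : Fin n → ℕ
  degree z = count (λ l → z ∈? L l)

  n≤1+s*degree : ∀ {s} → (∀ l → size l ≤ suc s) → ∀ z → n ≤ suc (s * degree z)
  n≤1+s*degree {s} size≤ z = begin
    n                                            ≡⟨ count-all {n} ⟨
    count (U? {A = Fin n})                       ≡⟨ count-remove U? {z} _ ⟩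
    suc (count (U? ∩? ∁? (_≟ z)))                ≤⟨ s≤s (count-union (U? ∩? ∁? (_≟ z)) R? onJoin) ⟩
    suc (sum (λ l → count (λ p → R? p l)))       ≤⟨ s≤s (∑-mono-≤ (λ l → fibre≤ l (z ∈? L l))) ⟩
    suc (sum (λ l → s * indicator (z ∈? L l)))   ≡⟨ cong suc (∑-* s (λ l → indicator (z ∈? L l))) ⟩
    suc (s * degree z)                           ∎
    where
    open ≤-Reasoning
    R : Fin n → Fin m → Set
    R p l = p ≢ z × z ∈ L l × p ∈ L l
    R? : ∀ p l → Dec (R p l)
    R? p l = ¬? (p ≟ z) ×-dec z ∈? L l ×-dec p ∈? L l
    onJoin : ∀ p → (U ∩ ∁ (_≡ z)) p → ∃ (R p)
    onJoin p (_ , p≢z) = let l , z∈l , p∈l = join z p (p≢z ∘ sym) in l , p≢z , z∈l , p∈l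
    fibre≤ : ∀ l → (z∈l? : Dec (z ∈ L l)) → count (λ p → R? p l) ≤ s * indicator z∈l?
    fibre≤ l (yes z∈l) = begin
      count (λ p → R? p l)             ≤⟨ count-mono (λ p → R? p l) ((_∈? L l) ∩? ∁? (_≟ z))
                                            (λ (p≢z , _ , p∈l) → p∈l , p≢z) ⟩
      count ((_∈? L l) ∩? ∁? (_≟ z))   ≤⟨ ≤-pred (subst (_≤ suc s) (count-remove (_∈? L l) z∈l) (size≤ l)) ⟩
      s                                ≡⟨ *-identityʳ s ⟨
      s * 1                            ∎
    fibre≤ l (no z∉l) =
      ≤-reflexive (trans (count-∅ (λ p → R? p l) (λ p (_ , z∈l , _) → z∉l z∈l)) (sym (*-zeroʳ s)))

module MRGeometry {n m : ℕ} {L : Fin m → Subset n} {c : Fin n → Bool} (mr : IsMRGeometry n m L c) where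

  open IsMRGeometry mr
  open IsLinearSpace linearSpace
  open LinearSpace linearSpace public

  IsRed IsGreen : Pred (Fin n) 0ℓ
  IsRed p = c p ≡ Red
  IsGreen p = c p ≡ Green

  red? : Decidable IsRed
  red? p = c p Bool.≟ Red

  green? : Decidable IsGreen
  green? p = c p Bool.≟ Green

  red≢green : ∀ {p q} → IsRed p → IsGreen q → p ≢ q
  red≢green p-red q-green refl with trans (sym p-red) q-green
  ... | ()

  ¬red⇒green : ∀ {p} → ¬ IsRed p → IsGreen p
  ¬red⇒green {p} ¬red with c p
  ... | true  = ⊥-elim (¬red refl)
  ... | false = refl

  green⇒¬red : ∀ {p} → IsGreen p → ¬ IsRed p
  green⇒¬red p-green p-red = red≢green p-red p-green refl

  n≡reds+greens : n ≡ count red? + count green?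
  n≡reds+greens = begin
    n                                            ≡⟨ count-all {n} ⟨
    count (U? {A = Fin n})                       ≡⟨ count-split U? red? ⟩
    count (U? ∩? red?) + count (U? ∩? ∁? red?)   ≡⟨ cong₂ _+_ (count-cong (U? ∩? red?) red? proj₂ (_ ,_))
                                                               (count-cong (U? ∩? ∁? red?) green? (¬red⇒green ∘ proj₂)
                                                                  λ p-green → _ , green⇒¬red p-green) ⟩
    count red? + count green?                    ∎
    where open ≡-Reasoning

  RedOn GreenOn GreenOff : Fin m → Pred (Fin n) 0ℓ
  RedOn l p = IsRed p × p ∈ L l
  GreenOn l p = IsGreen p × p ∈ L l
  GreenOff l p = IsGreen p × p ∉ L l

  redOn? : (l : Fin m) → Decidable (RedOn l)
  redOn? l p = red? p ×-dec p ∈? L l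

  greenOn? : (l : Fin m) → Decidable (GreenOn l)
  greenOn? l p = green? p ×-dec p ∈? L l

  greenOff? : (l : Fin m) → Decidable (GreenOff l)
  greenOff? l p = green? p ×-dec ¬? (p ∈? L l)

  0<redOn : ∀ l → 0 < count (redOn? l)
  0<redOn l = let x , x∈l , x-red = has-red l in 0<count (redOn? l) (x-red , x∈l)

  0<greenOn : ∀ l → 0 < count (greenOn? l)
  0<greenOn l = let g , g∈l , g-green = has-green l in 0<count (greenOn? l) (g-green , g∈l)

  size≡redOn+greenOn : ∀ l → size l ≡ count (redOn? l) + count (greenOn? l)
  size≡redOn+greenOn l = trans (count-split (_∈? L l) red?)
    (cong₂ _+_ (count-cong (λ p → p ∈? L l ×-dec red? p) (redOn? l) swap swap)
               (count-cong (λ p → p ∈? L l ×-dec ¬? (red? p)) (greenOn? l)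
                  (λ (p∈l , ¬red) → ¬red⇒green ¬red , p∈l) (λ (p-green , p∈l) → p∈l , green⇒¬red p-green)))

  greens≡greenOn+greenOff : ∀ l → count green? ≡ count (greenOn? l) + count (greenOff? l)
  greens≡greenOn+greenOff l = count-split green? (_∈? L l)

  join-red : ∀ {p q} → p ≢ q → ∃[ r ] (IsRed r × Collinear p q r)
  join-red p≢q with join _ _ p≢q
  ... | l , p∈l , q∈l with has-red l
  ...   | r , r∈l , r-red = r , r-red , l , p∈l , q∈l , r∈l

  join-green : ∀ {p q} → p ≢ q → ∃[ g ] (IsGreen g × Collinear p q g)
  join-green p≢q with join _ _ p≢q
  ... | l , p∈l , q∈l with has-green l
  ...   | g , g∈l , g-green = g , g-green , l , p∈l , q∈l , g∈l

  ≢-on-other-line : ∀ {z l l′ u g} → IsRed z → z ∈ L l → z ∈ L l′ → l ≢ l′ →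
                    IsGreen u → u ∈ L l′ → g ∈ L l → g ≢ u
  ≢-on-other-line z-red z∈l z∈l′ l≢l′ u-green u∈l′ g∈l refl =
    l≢l′ (same-line (red≢green z-red u-green) z∈l g∈l z∈l′ u∈l′)

  degree≤ : ∀ {z q} {Q : Pred (Fin n) q} (Q? : Decidable Q) → IsRed z →
            (∀ l → z ∈ L l → ∃[ g ] (IsGreen g × g ∈ L l × Q g)) → degree z ≤ count (green? ∩? Q?)
  degree≤ {z} Q? z-red greenOn =
    count-injective (λ l → z ∈? L l) (green? ∩? Q?) (λ l z∈l → proj₁ (greenOn l z∈l))
      (λ l z∈l → let _ , g-green , _ , Qg = greenOn l z∈l in g-green , Qg)
      λ l l′ z∈l z∈l′ same-green →
        let _ , g-green , g∈l , _ = greenOn l z∈l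
            _ , _ , g∈l′ , _ = greenOn l′ z∈l′
        in same-line (red≢green z-red g-green) z∈l g∈l z∈l′ (subst (λ g → g ∈ L l′) (sym same-green) g∈l′)

  fan : ∀ {l y q} {Q : Pred (Fin n) q} (Q? : Decidable Q) → IsRed y → y ∉ L l →
        (∀ x → RedOn l x → ∃[ g ] (IsGreen g × Collinear y x g × Q g)) →
        count (redOn? l) ≤ count (greenOff? l ∩? Q?)
  fan {l} {Q = Q} Q? y-red y∉l greenOnFanLine =
    count-injective (redOn? l) (greenOff? l ∩? Q?) (λ x Ax → proj₁ (greenOnFanLine x Ax)) f∈ f-inj
    where
    f∈ : ∀ x Ax → (GreenOff l ∩ Q) (proj₁ (greenOnFanLine x Ax))
    f∈ x Ax@(x-red , x∈l) with greenOnFanLine x Ax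
    ... | g , g-green , col , Qg = (g-green , λ g∈l → red≢green x-red g-green (meets-once y∉l x∈l g∈l col)) , Qg
    f-inj : ∀ x x′ Ax Ax′ → proj₁ (greenOnFanLine x Ax) ≡ proj₁ (greenOnFanLine x′ Ax′) → x ≡ x′
    f-inj x x′ Ax Ax′ eq with greenOnFanLine x Ax | greenOnFanLine x′ Ax′
    f-inj x x′ (_ , x∈l) (_ , x′∈l) refl | g , g-green , col , _ | _ , _ , col′ , _ =
      meets-once y∉l x∈l x′∈l (collinear-pivot (red≢green y-red g-green) col col′)

  greenOff-witness : ∀ l → ∃ (GreenOff l)
  greenOff-witness l with nontrivial l
  ... | p , p∉l with red? p
  ...   | no ¬red = p , ¬red⇒green ¬red , p∉l
  ...   | yes _ with has-red l
  ...     | x , x∈l , x-red with join-green (∉⇒≢ p∉l x∈l)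
  ...       | g , g-green , col = g , g-green , λ g∈l → red≢green x-red g-green (meets-once p∉l x∈l g∈l col)

  -- The centre of a fan missing h; apex takes the red point of the line joining h to a green point of l.
  record Apex (l : Fin m) (h y : Fin n) : Set where
    field
      red    : IsRed y
      off    : y ∉ L l
      avoids : ∀ {x} → RedOn l x → ¬ Collinear y x h

  apex : ∀ {l h} → GreenOff l h → ∃ (Apex l h)
  apex {l} {h} (h-green , h∉l) with has-green l
  ... | β , β∈l , β-green with join-red (∉⇒≢ h∉l β∈l ∘ sym)
  ...   | y , y-red , l₁ , β∈l₁ , h∈l₁ , y∈l₁ = y , record { red = y-red ; off = y∉l ; avoids = avoids }
    where
    y∉l : y ∉ L l
    y∉l y∈l = h∉l (collinear⇒∈ (red≢green y-red β-green ∘ sym) β∈l y∈l (l₁ , β∈l₁ , y∈l₁ , h∈l₁))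
    avoids : ∀ {x} → RedOn l x → ¬ Collinear y x h
    avoids {x} (x-red , x∈l) (l₂ , y∈l₂ , x∈l₂ , h∈l₂) =
      h∉l (collinear⇒∈ (red≢green x-red β-green) x∈l β∈l (l₁ , x∈l₁ , β∈l₁ , h∈l₁))
      where
      x∈l₁ : x ∈ L l₁
      x∈l₁ = collinear⇒∈ (red≢green y-red h-green) y∈l₁ h∈l₁ (l₂ , y∈l₂ , h∈l₂ , x∈l₂)

  redOn<greenOff : ∀ l → count (redOn? l) < count (greenOff? l)
  redOn<greenOff l with greenOff-witness l
  ... | h , Gh with apex Gh
  ...   | y , y-apex = begin-strict
    count (redOn? l)                  ≤⟨ fan (∁? (_≟ h)) red off greenOnFanLine ⟩
    count (greenOff? l ∩? ∁? (_≟ h))  <⟨ ≤-reflexive (sym (count-remove (greenOff? l) Gh)) ⟩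
    count (greenOff? l)               ∎
    where
    open ≤-Reasoning
    open Apex y-apex
    greenOnFanLine : ∀ x → RedOn l x → ∃[ g ] (IsGreen g × Collinear y x g × g ≢ h)
    greenOnFanLine x Ax with join-green (∉⇒≢ off (proj₂ Ax))
    ... | g , g-green , col = g , g-green , col , λ { refl → avoids Ax col }

  size<greens : ∀ l → size l < count green?
  size<greens l = begin-strict
    size l                                    ≡⟨ size≡redOn+greenOn l ⟩
    count (redOn? l) + count (greenOn? l)     <⟨ +-monoˡ-< (count (greenOn? l)) (redOn<greenOff l) ⟩
    count (greenOff? l) + count (greenOn? l)  ≡⟨ +-comm _ (count (greenOn? l)) ⟩
    count (greenOn? l) + count (greenOff? l)  ≡⟨ greens≡greenOn+greenOff l ⟨
    count green?                              ∎
    where open ≤-Reasoning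

  Alone : Fin n → Fin n → Set
  Alone x g = ∀ v → IsGreen v → Collinear x g v → v ≡ g

  alone? : ∀ x g → Dec (Alone x g)
  alone? x g = all? λ v → green? v →-dec collinear? x g v →-dec v ≟ g

  module TightLine (l : Fin m) (tight : count (greenOff? l) ≡ suc (count (redOn? l))) where

    ¬fan-avoiding : ∀ {y h u} → IsRed y → y ∉ L l → GreenOff l h → GreenOff l u → h ≢ u →
                    ¬ (∀ x → RedOn l x → ∃[ g ] (IsGreen g × Collinear y x g × g ≢ h × g ≢ u))
    ¬fan-avoiding {h = h} {u} y-red y∉l Gh Gu h≢u greenOnFanLine = <-irrefl refl (begin-strict
      count (redOn? l)                     ≤⟨ fan avoid? y-red y∉l greenOnFanLine ⟩
      count (greenOff? l ∩? avoid?)        <⟨ n<1+n _ ⟩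
      suc (count (greenOff? l ∩? avoid?))  ≡⟨ ℕ.suc-injective (trans (sym (count-remove₂ (greenOff? l) Gh Gu h≢u)) tight) ⟩
      count (redOn? l)                     ∎)
      where
      open ≤-Reasoning
      avoid? : Decidable (∁ (_≡ h) ∩ ∁ (_≡ u))
      avoid? = ∁? (_≟ h) ∩? ∁? (_≟ u)

    fan-covers : ∀ {h y u} → GreenOff l h → Apex l h y → GreenOff l u → u ≢ h →
                 ∃[ x ] (RedOn l x × Collinear y x u)
    fan-covers {h} {y} {u} Gh y-apex Gu u≢h with any? (λ x → redOn? l x ×-dec collinear? y x u)
    ... | yes covered  = covered
    ... | no uncovered = ⊥-elim (¬fan-avoiding red off Gh Gu (u≢h ∘ sym) greenOnFanLine)
      where
      open Apex y-apex
      greenOnFanLine : ∀ x → RedOn l x → ∃[ g ] (IsGreen g × Collinear y x g × g ≢ h × g ≢ u)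
      greenOnFanLine x Ax with join-green (∉⇒≢ off (proj₂ Ax))
      ... | g , g-green , col =
        g , g-green , col , (λ { refl → avoids Ax col }) , λ { refl → uncovered (x , Ax , col) }

    apexLine-green-unique : ∀ {h y x v w} → GreenOff l h → Apex l h y → RedOn l x → IsGreen v → IsGreen w →
                            Collinear y x v → Collinear y x w → v ≡ w
    apexLine-green-unique {h} {y} {x} {v} {w} Gh y-apex Ax@(x-red , x∈l) v-green w-green col-v col-w with v ≟ w
    ... | yes v≡w = v≡w
    ... | no v≢w  = ⊥-elim (¬fan-avoiding red off Gh Gv (λ { refl → avoids Ax col-v }) greenOnFanLine)
      where
      open Apex y-apex
      Gv : GreenOff l v
      Gv = v-green , λ v∈l → red≢green x-red v-green (meets-once off x∈l v∈l col-v)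
      greenOnFanLine : ∀ x′ → RedOn l x′ → ∃[ g ] (IsGreen g × Collinear y x′ g × g ≢ h × g ≢ v)
      greenOnFanLine x′ Ax′ with x′ ≟ x
      ... | yes refl = w , w-green , col-w , (λ { refl → avoids Ax col-w }) , v≢w ∘ sym
      ... | no x′≢x with join-green (∉⇒≢ off (proj₂ Ax′))
      ...   | g , g-green , col = g , g-green , col , (λ { refl → avoids Ax′ col }) , λ { refl →
                x′≢x (meets-once off (proj₂ Ax′) x∈l (collinear-pivot (red≢green red v-green) col col-v)) }

    apexLine-green-alone : ∀ {h y x v} → GreenOff l h → Apex l h y → RedOn l x → IsGreen v →
                           Collinear y x v → Alone x v
    apexLine-green-alone Gh y-apex Ax v-green col-v@(l₁ , y∈l₁ , x∈l₁ , v∈l₁) w w-green col-xvw =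
      sym (apexLine-green-unique Gh y-apex Ax v-green w-green col-v
             (l₁ , y∈l₁ , x∈l₁ , collinear⇒∈ (red≢green (proj₁ Ax) v-green) x∈l₁ v∈l₁ col-xvw))

    apexLine-green : ∀ {h y x} → GreenOff l h → Apex l h y → RedOn l x →
                     ∃[ g ] (GreenOff l g × Alone x g × g ≢ h)
    apexLine-green Gh y-apex Ax@(x-red , x∈l) with join-green (∉⇒≢ (Apex.off y-apex) x∈l)
    ... | g , g-green , col =
      g , (g-green , λ g∈l → red≢green x-red g-green (meets-once (Apex.off y-apex) x∈l g∈l col)) ,
      apexLine-green-alone Gh y-apex Ax g-green col , λ { refl → Apex.avoids y-apex Ax col }

    greens-meet-redOn : ∀ {h u} → GreenOff l h → GreenOff l u → h ≢ u → ∃[ x ] (RedOn l x × Collinear h u x)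
    greens-meet-redOn {h} {u} Gh Gu h≢u with any? (λ x → redOn? l x ×-dec collinear? h u x)
    ... | yes met = met
    ... | no unmet with join-red h≢u
    ...   | r , r-red , col-hur@(l₁ , h∈l₁ , u∈l₁ , r∈l₁) =
      ⊥-elim (¬fan-avoiding r-red r∉l Gh Gu h≢u greenOnFanLine)
      where
      r∉l : r ∉ L l
      r∉l r∈l = unmet (r , (r-red , r∈l) , col-hur)
      ∉join : ∀ {x g} → RedOn l x → IsGreen g → Collinear r x g → g ∉ L l₁
      ∉join {x} Ax g-green (l₂ , r∈l₂ , x∈l₂ , g∈l₂) g∈l₁ =
        unmet (x , Ax , l₁ , h∈l₁ , u∈l₁ , collinear⇒∈ (red≢green r-red g-green) r∈l₁ g∈l₁ (l₂ , r∈l₂ , g∈l₂ , x∈l₂))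
      greenOnFanLine : ∀ x → RedOn l x → ∃[ g ] (IsGreen g × Collinear r x g × g ≢ h × g ≢ u)
      greenOnFanLine x Ax with join-green (∉⇒≢ r∉l (proj₂ Ax))
      ... | g , g-green , col =
        g , g-green , col , (λ { refl → ∉join Ax g-green col h∈l₁ }) , λ { refl → ∉join Ax g-green col u∈l₁ }

    aloneAt? : (x : Fin n) → Decidable (GreenOff l ∩ Alone x)
    aloneAt? x = greenOff? l ∩? alone? x

    crowdedAt? : (x : Fin n) → Decidable (GreenOff l ∩ ∁ (Alone x))
    crowdedAt? x = greenOff? l ∩? ∁? (alone? x)

    -- The green on a fan line from an apex is alone; its own apex yields a second one.
    two-alone : ∀ {x} → RedOn l x → 2 ≤ count (aloneAt? x)
    two-alone {x} Ax with greenOff-witness l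
    ... | h , Gh with apex Gh
    ...   | y , y-apex with apexLine-green Gh y-apex Ax
    ...     | g₁ , Gg₁ , alone₁ , _ with apex Gg₁
    ...       | y₁ , y₁-apex with apexLine-green Gg₁ y₁-apex Ax
    ...         | g₂ , Gg₂ , alone₂ , g₂≢g₁ = count-≥2 (aloneAt? x) (Gg₁ , alone₁) (Gg₂ , alone₂) (g₂≢g₁ ∘ sym)

    crowded+2≤ : ∀ {x} → RedOn l x → count (crowdedAt? x) + 2 ≤ suc (count (redOn? l))
    crowded+2≤ {x} Ax = begin
      count (crowdedAt? x) + 2                   ≤⟨ +-monoʳ-≤ (count (crowdedAt? x)) (two-alone Ax) ⟩
      count (crowdedAt? x) + count (aloneAt? x)  ≡⟨ +-comm (count (crowdedAt? x)) _ ⟩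
      count (aloneAt? x) + count (crowdedAt? x)  ≡⟨ count-split (greenOff? l) (alone? x) ⟨
      count (greenOff? l)                        ≡⟨ tight ⟩
      suc (count (redOn? l))                     ∎
      where open ≤-Reasoning

    others≡redOn : ∀ {g} → GreenOff l g → count (greenOff? l ∩? ∁? (_≟ g)) ≡ count (redOn? l)
    others≡redOn Gg = ℕ.suc-injective (trans (sym (count-remove (greenOff? l) Gg)) tight)

    alone-somewhere : ∀ {g} → GreenOff l g → ∃[ x ] (RedOn l x × Alone x g)
    alone-somewhere {g} Gg@(g-green , _)
      with count-witness (greenOff? l ∩? ∁? (_≟ g)) (subst (0 <_) (sym (others≡redOn Gg)) (0<redOn l))
    ... | u , Gu , u≢g with apex Gu
    ...   | y , y-apex with fan-covers Gu y-apex Gg (u≢g ∘ sym)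
    ...     | x , Ax , col = x , Ax , apexLine-green-alone Gu y-apex Ax g-green col

    3≤crowdedAt : ∀ {h v v′ x} → GreenOff l h → GreenOff l v → GreenOff l v′ → h ≢ v → h ≢ v′ → v ≢ v′ →
                  RedOn l x → Collinear h v x → Collinear h v′ x → 3 ≤ count (crowdedAt? x)
    3≤crowdedAt {v′ = v′} Gh@(h-green , _) Gv@(v-green , _) Gv′ h≢v h≢v′ v≢v′ (x-red , _)
                (l₁ , h∈l₁ , v∈l₁ , x∈l₁) (l₂ , h∈l₂ , v′∈l₂ , x∈l₂) =
      count-≥3 (crowdedAt? _)
        (Gh , λ alone → h≢v (sym (alone _ v-green (l₁ , x∈l₁ , h∈l₁ , v∈l₁))))
        (Gv , λ alone → h≢v (alone _ h-green (l₁ , x∈l₁ , v∈l₁ , h∈l₁)))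
        (Gv′ , λ alone → h≢v′ (alone _ h-green (l₁ , x∈l₁ , v′∈l₁ , h∈l₁)))
        h≢v h≢v′ v≢v′
      where
      v′∈l₁ : v′ ∈ L l₁
      v′∈l₁ = collinear⇒∈ (red≢green x-red h-green ∘ sym) h∈l₁ x∈l₁ (l₂ , h∈l₂ , x∈l₂ , v′∈l₂)

    -- Send v ∈ G′ ∖ {h} to the red point of l on the line hv.  This misses x₀, and it is injective
    -- because two greens sharing that point would make three greens crowded there.
    ¬redOn≤3 : ∀ {h x₀} → GreenOff l h → RedOn l x₀ → Alone x₀ h → ¬ count (redOn? l) ≤ 3
    ¬redOn≤3 {h} {x₀} Gh Ax₀ alone₀ a≤3 = <-irrefl refl (begin-strict
      count (redOn? l)                      ≡⟨ others≡redOn Gh ⟨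
      count (greenOff? l ∩? ∁? (_≟ h))      ≤⟨ count-injective (greenOff? l ∩? ∁? (_≟ h)) (redOn? l ∩? ∁? (_≟ x₀))
                                                 (λ v Gv → proj₁ (meet Gv)) meet∈ meet-inj ⟩
      count (redOn? l ∩? ∁? (_≟ x₀))        <⟨ n<1+n _ ⟩
      suc (count (redOn? l ∩? ∁? (_≟ x₀)))  ≡⟨ count-remove (redOn? l) Ax₀ ⟨
      count (redOn? l)                      ∎)
      where
      open ≤-Reasoning
      meet : ∀ {v} → (GreenOff l ∩ ∁ (_≡ h)) v → ∃[ x ] (RedOn l x × Collinear h v x)
      meet (Gv , v≢h) = greens-meet-redOn Gh Gv (v≢h ∘ sym)
      meet∈ : ∀ v Gv → (RedOn l ∩ ∁ (_≡ x₀)) (proj₁ (meet {v} Gv))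
      meet∈ v Gv@((v-green , _) , v≢h) with meet Gv
      ... | x , Ax , l₁ , h∈l₁ , v∈l₁ , x∈l₁ = Ax , λ { refl → v≢h (alone₀ v v-green (l₁ , x∈l₁ , h∈l₁ , v∈l₁)) }
      meet-inj : ∀ v v′ Gv Gv′ → proj₁ (meet {v} Gv) ≡ proj₁ (meet {v′} Gv′) → v ≡ v′
      meet-inj v v′ Gv@(Gv₀ , v≢h) Gv′@(Gv′₀ , v′≢h) same with v ≟ v′
      ... | yes v≡v′ = v≡v′
      ... | no v≢v′ with meet Gv | meet Gv′ | same
      ...   | x , Ax , col | _ , _ , col′ | refl = ⊥-elim (<-irrefl refl (begin-strict
        4                             <⟨ n<1+n 4 ⟩
        5                             ≤⟨ +-monoˡ-≤ 2 (3≤crowdedAt Gh Gv₀ Gv′₀ (v≢h ∘ sym) (v′≢h ∘ sym) v≢v′ Ax col col′) ⟩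
        count (crowdedAt? x) + 2      ≤⟨ crowded+2≤ Ax ⟩
        suc (count (redOn? l))        ≤⟨ s≤s a≤3 ⟩
        4                             ∎))

    4≤redOn : 4 ≤ count (redOn? l)
    4≤redOn = let h , Gh = greenOff-witness l ; x₀ , Ax₀ , alone₀ = alone-somewhere Gh in
              ≰⇒> (¬redOn≤3 Gh Ax₀ alone₀)

module SixGreens {n m : ℕ} {L : Fin m → Subset n} {c : Fin n → Bool} (mr : IsMRGeometry n m L c)
                 (six : count (MRGeometry.green? mr) ≡ 6) where

  open IsMRGeometry mr
  open IsLinearSpace linearSpace
  open MRGeometry mr

  size≤5 : ∀ l → size l ≤ 5
  size≤5 l = ≤-pred (subst (size l <_) six (size<greens l))

  module FiveLine (l : Fin m) (size≡5 : size l ≡ 5) where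

    tight : count (greenOff? l) ≡ suc (count (redOn? l))
    tight = +-cancelˡ-≡ (count (greenOn? l)) _ _ (begin
      count (greenOn? l) + count (greenOff? l)     ≡⟨ greens≡greenOn+greenOff l ⟨
      count green?                                 ≡⟨ six ⟩
      6                                            ≡⟨ cong suc size≡5 ⟨
      suc (size l)                                 ≡⟨ cong suc (size≡redOn+greenOn l) ⟩
      suc (count (redOn? l) + count (greenOn? l))  ≡⟨ cong suc (+-comm (count (redOn? l)) _) ⟩
      suc (count (greenOn? l) + count (redOn? l))  ≡⟨ +-suc (count (greenOn? l)) _ ⟨
      count (greenOn? l) + suc (count (redOn? l))  ∎)
      where open ≡-Reasoning

    open TightLine l tight

    redOn≡4 : count (redOn? l) ≡ 4
    redOn≡4 = ≤-antisym redOn≤4 4≤redOn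
      where
      open ≤-Reasoning
      redOn≤4 : count (redOn? l) ≤ 4
      redOn≤4 = ≤-pred (begin
        suc (count (redOn? l))                 ≡⟨ +-comm 1 _ ⟩
        count (redOn? l) + 1                   ≤⟨ +-monoʳ-≤ (count (redOn? l)) (0<greenOn l) ⟩
        count (redOn? l) + count (greenOn? l)  ≡⟨ size≡redOn+greenOn l ⟨
        size l                                 ≡⟨ size≡5 ⟩
        5                                      ∎)

    -- If g were alone only at x₀, the apexes of the four greens of G′ ∖ {g} would all lie on the
    -- line x₀g, giving it six points.
    ¬alone-only-at : ∀ {g x₀} → GreenOff l g → RedOn l x₀ → (∀ {x} → RedOn l x → Alone x g → x ≡ x₀) → ⊥
    ¬alone-only-at {g} {x₀} Gg@(g-green , _) (x₀-red , x₀∈l) only-x₀ = <-irrefl refl (begin-strict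
      count onℓ?                        ≤⟨ ≤-pred (≤-pred (subst (_≤ 5) (count-remove₂ (_∈? L ℓ) x₀∈ℓ g∈ℓ x₀≢g) (size≤5 ℓ))) ⟩
      3                                 <⟨ n<1+n 3 ⟩
      4                                 ≡⟨ redOn≡4 ⟨
      count (redOn? l)                  ≡⟨ others≡redOn Gg ⟨
      count (greenOff? l ∩? ∁? (_≟ g))  ≤⟨ count-injective (greenOff? l ∩? ∁? (_≟ g)) onℓ? apexOf apexOf∈ apexOf-inj ⟩
      count onℓ?                        ∎)
      where
      open ≤-Reasoning
      x₀≢g : x₀ ≢ g
      x₀≢g = red≢green x₀-red g-green
      ℓ : Fin m
      ℓ = proj₁ (join x₀ g x₀≢g)
      x₀∈ℓ : x₀ ∈ L ℓ
      x₀∈ℓ = proj₁ (proj₂ (join x₀ g x₀≢g))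
      g∈ℓ : g ∈ L ℓ
      g∈ℓ = proj₂ (proj₂ (join x₀ g x₀≢g))
      onℓ? : Decidable (λ y → y ∈ L ℓ × (y ≢ x₀ × y ≢ g))
      onℓ? = (_∈? L ℓ) ∩? (∁? (_≟ x₀) ∩? ∁? (_≟ g))
      apexOf : ∀ u → (GreenOff l ∩ ∁ (_≡ g)) u → Fin n
      apexOf u (Gu , _) = proj₁ (apex Gu)
      apex∈ℓ : ∀ {u y} → GreenOff l u → u ≢ g → Apex l u y → y ∈ L ℓ × (y ≢ x₀ × y ≢ g)
      apex∈ℓ Gu u≢g y-apex with fan-covers Gu y-apex Gg (u≢g ∘ sym)
      ... | x , Ax , col@(l₁ , y∈l₁ , x∈l₁ , g∈l₁) with only-x₀ Ax (apexLine-green-alone Gu y-apex Ax g-green col)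
      ...   | refl = collinear⇒∈ x₀≢g x₀∈ℓ g∈ℓ (l₁ , x∈l₁ , g∈l₁ , y∈l₁) ,
                     (λ { refl → Apex.off y-apex x₀∈l }) , red≢green (Apex.red y-apex) g-green
      apexOf∈ : ∀ u Gu → apexOf u Gu ∈ L ℓ × (apexOf u Gu ≢ x₀ × apexOf u Gu ≢ g)
      apexOf∈ u (Gu , u≢g) = apex∈ℓ Gu u≢g (proj₂ (apex Gu))
      apexOf-inj : ∀ u u′ Gu Gu′ → apexOf u Gu ≡ apexOf u′ Gu′ → u ≡ u′
      apexOf-inj u u′ (Gu , _) (Gu′ , _) same-apex with u ≟ u′
      ... | yes u≡u′ = u≡u′
      ... | no u≢u′ with fan-covers Gu (proj₂ (apex Gu)) Gu′ (u≢u′ ∘ sym)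
      ...   | x , Ax , col = ⊥-elim (Apex.avoids (proj₂ (apex Gu′)) Ax (subst (λ y → Collinear y x u′) same-apex col))

    alone-twice : ∀ {g} → GreenOff l g → 2 ≤ count (λ x → redOn? l x ×-dec alone? x g)
    alone-twice {g} Gg with 2 ≤? count (λ x → redOn? l x ×-dec alone? x g)
    ... | yes twice = twice
    ... | no ¬twice =
      let x₀ , Ax₀ , alone₀ = alone-somewhere Gg in
      ⊥-elim (¬alone-only-at Gg Ax₀ λ Ax alone →
        count≤1⇒≡ (λ x → redOn? l x ×-dec alone? x g) (≤-pred (≰⇒> ¬twice)) (Ax , alone) (Ax₀ , alone₀))

    Partner : Fin n → Fin n → Pred (Fin n) 0ℓ
    Partner g x v = (GreenOff l v × v ≢ g) × RedOn l x × Collinear x g v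

    partner? : ∀ g x → Decidable (Partner g x)
    partner? g x v = (greenOff? l ∩? ∁? (_≟ g)) v ×-dec redOn? l x ×-dec collinear? x g v

    Crowded : Fin n → Pred (Fin n) 0ℓ
    Crowded g x = RedOn l x × ¬ Alone x g

    crowded? : ∀ g → Decidable (Crowded g)
    crowded? g x = redOn? l x ×-dec ¬? (alone? x g)

    partners≤crowdedAt : ∀ {g x} → GreenOff l g → count (partner? g x) ≤ count (crowdedAt? x ∩? ∁? (_≟ g))
    partners≤crowdedAt {g} {x} (g-green , _) = count-mono (partner? g x) (crowdedAt? x ∩? ∁? (_≟ g))
      λ ((Gv , v≢g) , _ , l₁ , x∈l₁ , g∈l₁ , v∈l₁) →
        (Gv , λ alone → v≢g (sym (alone g g-green (l₁ , x∈l₁ , v∈l₁ , g∈l₁)))) , v≢g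

    partners≤ : ∀ {g} → GreenOff l g → ∀ x → count (partner? g x) ≤ 2 * indicator (crowded? g x)
    partners≤ {g} Gg x with crowded? g x
    ... | no ¬crowded = ≤-reflexive (count-∅ (partner? g x)
            λ v (((v-green , _) , v≢g) , Ax , col) → ¬crowded (Ax , λ alone → v≢g (alone v v-green col)))
    ... | yes (Ax , ¬alone) = ≤-trans (partners≤crowdedAt Gg) (+-cancelʳ-≤ 2 _ 2 (≤-pred (begin
      suc (count (crowdedAt? x ∩? ∁? (_≟ g))) + 2  ≡⟨ cong (_+ 2) (count-remove (crowdedAt? x) (Gg , ¬alone)) ⟨
      count (crowdedAt? x) + 2                     ≤⟨ crowded+2≤ Ax ⟩
      suc (count (redOn? l))                       ≡⟨ cong suc redOn≡4 ⟩
      5                                            ∎)))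
      where open ≤-Reasoning

    4≤∑partners : ∀ {g} → GreenOff l g → 4 ≤ sum (λ x → count (partner? g x))
    4≤∑partners {g} Gg = begin
      4                                 ≡⟨ redOn≡4 ⟨
      count (redOn? l)                  ≡⟨ others≡redOn Gg ⟨
      count (greenOff? l ∩? ∁? (_≟ g))  ≤⟨ count-union (greenOff? l ∩? ∁? (_≟ g)) (λ v x → partner? g x v) meets ⟩
      sum (λ x → count (partner? g x))  ∎
      where
      open ≤-Reasoning
      meets : ∀ v → (GreenOff l ∩ ∁ (_≡ g)) v → ∃ (λ x → Partner g x v)
      meets v Pv@(Gv , v≢g) with greens-meet-redOn Gg Gv (v≢g ∘ sym)
      ... | x , Ax , l₁ , g∈l₁ , v∈l₁ , x∈l₁ = x , Pv , Ax , l₁ , x∈l₁ , g∈l₁ , v∈l₁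

    ∑partners≤ : ∀ {g} → GreenOff l g → sum (λ x → count (partner? g x)) ≤ 2 * count (crowded? g)
    ∑partners≤ {g} Gg = ≤-trans (∑-mono-≤ (partners≤ Gg)) (≤-reflexive (∑-* 2 (λ x → indicator (crowded? g x))))

    crowded≡2 : ∀ {g} → GreenOff l g → count (crowded? g) ≡ 2
    crowded≡2 {g} Gg = ≤-antisym crowded≤2 (*-cancelˡ-≤ 2 (≤-trans (4≤∑partners Gg) (∑partners≤ Gg)))
      where
      open ≤-Reasoning
      crowded≤2 : count (crowded? g) ≤ 2
      crowded≤2 = +-cancelˡ-≤ 2 _ _ (begin
        2 + count (crowded? g)                                          ≤⟨ +-monoˡ-≤ _ (alone-twice Gg) ⟩
        count (λ x → redOn? l x ×-dec alone? x g) + count (crowded? g)  ≡⟨ count-split (redOn? l) (λ x → alone? x g) ⟨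
        count (redOn? l)                                                ≡⟨ redOn≡4 ⟩
        4                                                               ∎)

    -- The bound 4 ≤ ∑ partners ≤ 2 · count (crowded? g) = 4 is tight, so each line xg through a
    -- point x at which g is crowded carries exactly two partners of g.
    crowded⇒3≤crowdedAt : ∀ {g x} → GreenOff l g → Crowded g x → 3 ≤ count (crowdedAt? x)
    crowded⇒3≤crowdedAt {g} {x} Gg cr@(Ax , ¬alone) with 2 ≤? count (partner? g x)
    ... | yes 2≤partners = begin
      3                                        ≤⟨ s≤s 2≤partners ⟩
      suc (count (partner? g x))               ≤⟨ s≤s (partners≤crowdedAt Gg) ⟩
      suc (count (crowdedAt? x ∩? ∁? (_≟ g)))  ≡⟨ count-remove (crowdedAt? x) (Gg , ¬alone) ⟨
      count (crowdedAt? x)                     ∎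
      where open ≤-Reasoning
    ... | no ¬2≤partners = ⊥-elim (<-irrefl refl (begin-strict
      4                                         ≤⟨ 4≤∑partners Gg ⟩
      sum (λ x → count (partner? g x))          <⟨ ∑-mono-< (partners≤ Gg) x partners<2 ⟩
      sum (λ x → 2 * indicator (crowded? g x))  ≡⟨ ∑-* 2 (λ x → indicator (crowded? g x)) ⟩
      2 * count (crowded? g)                    ≡⟨ cong (2 *_) (crowded≡2 Gg) ⟩
      4                                         ∎))
      where
      open ≤-Reasoning
      partners<2 : count (partner? g x) < 2 * indicator (crowded? g x)
      partners<2 with crowded? g x
      ... | yes _  = ≰⇒> ¬2≤partners
      ... | no ¬cr = ⊥-elim (¬cr cr)

    3∣crowdedAt : ∀ {x} → RedOn l x → 3 ∣ count (crowdedAt? x)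
    3∣crowdedAt {x} Ax with any? (crowdedAt? x)
    ... | yes (g , Gg , ¬alone) = ∣-reflexive (≤-antisym (crowded⇒3≤crowdedAt Gg (Ax , ¬alone)) crowdedAt≤3)
      where
      crowdedAt≤3 : count (crowdedAt? x) ≤ 3
      crowdedAt≤3 = +-cancelʳ-≤ 2 _ 3 (subst (count (crowdedAt? x) + 2 ≤_) (cong suc redOn≡4) (crowded+2≤ Ax))
    ... | no none = subst (3 ∣_) (sym (count-∅ (crowdedAt? x) (λ g cr → none (g , cr)))) (3 ∣0)

    Incidence : Fin n → Fin n → Set
    Incidence g x = GreenOff l g × Crowded g x

    incidence? : ∀ g x → Dec (Incidence g x)
    incidence? g x = greenOff? l g ×-dec crowded? g x

    row : ∀ g → (Gg? : Dec (GreenOff l g)) → count (incidence? g) ≡ 2 * indicator Gg?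
    row g (yes Gg) = trans (count-cong (incidence? g) (crowded? g) proj₂ (Gg ,_)) (crowded≡2 Gg)
    row g (no ¬Gg) = count-∅ (incidence? g) (λ x → ¬Gg ∘ proj₁)

    3∣column : ∀ x → Dec (RedOn l x) → 3 ∣ count (λ g → incidence? g x)
    3∣column x (yes Ax) = subst (3 ∣_) (count-cong (crowdedAt? x) (λ g → incidence? g x)
                            (λ (Gg , ¬alone) → Gg , Ax , ¬alone) (λ (Gg , _ , ¬alone) → Gg , ¬alone)) (3∣crowdedAt Ax)
    3∣column x (no ¬Ax) = subst (3 ∣_) (sym (count-∅ (λ g → incidence? g x) (λ g (_ , Ax , _) → ¬Ax Ax))) (3 ∣0)

    impossible : ⊥
    impossible = from-no (3 ∣? 10) (subst (3 ∣_) total (∣-∑ _ (λ x → 3∣column x (redOn? l x))))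
      where
      open ≡-Reasoning
      total : sum (λ x → count (λ g → incidence? g x)) ≡ 10
      total = begin
        sum (λ x → count (λ g → incidence? g x))   ≡⟨ ∑-comm (λ x g → indicator (incidence? g x)) ⟩
        sum (λ g → count (incidence? g))           ≡⟨ sum-cong-≗ (λ g → row g (greenOff? l g)) ⟩
        sum (λ g → 2 * indicator (greenOff? l g))  ≡⟨ ∑-* 2 (λ g → indicator (greenOff? l g)) ⟩
        2 * count (greenOff? l)                    ≡⟨ cong (2 *_) (trans tight (cong suc redOn≡4)) ⟩
        10                                         ∎

  size≤4 : ∀ l → size l ≤ 4
  size≤4 l with m≤n⇒m<n∨m≡n (size≤5 l)
  ... | inj₁ size<5 = ≤-pred size<5
  ... | inj₂ size≡5 = ⊥-elim (FiveLine.impossible l size≡5)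

  greens∖₂≡4 : ∀ {a b} → IsGreen a → IsGreen b → a ≢ b → count (green? ∩? (∁? (_≟ a) ∩? ∁? (_≟ b))) ≡ 4
  greens∖₂≡4 a-green b-green a≢b =
    ℕ.suc-injective (ℕ.suc-injective (trans (sym (count-remove₂ green? a-green b-green a≢b)) six))

  degree≤6 : ∀ {z} → IsRed z → degree z ≤ 6
  degree≤6 {z} z-red = begin
    degree z              ≤⟨ degree≤ U? z-red (λ l _ → let g , g∈l , g-green = has-green l in g , g-green , g∈l , _) ⟩
    count (green? ∩? U?)  ≡⟨ count-cong (green? ∩? U?) green? proj₁ (_, _) ⟩
    count green?          ≡⟨ six ⟩
    6                     ∎
    where open ≤-Reasoning

  module ManyPoints (14≤n : 14 ≤ n) where

    5≤degree : ∀ {z} → IsRed z → 5 ≤ degree z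
    5≤degree {z} z-red = *-cancelˡ-< 3 4 (degree z) (≤-pred (≤-trans 14≤n (n≤1+s*degree size≤4 z)))

    ¬lines-avoid-two-greens : ∀ {z a b} → IsRed z → IsGreen a → IsGreen b → a ≢ b →
                              ¬ (∀ l → z ∈ L l → ∃[ g ] (IsGreen g × g ∈ L l × g ≢ a × g ≢ b))
    ¬lines-avoid-two-greens {z} {a} {b} z-red a-green b-green a≢b greenAvoiding = <-irrefl refl (begin-strict
      4                                           <⟨ 5≤degree z-red ⟩
      degree z                                    ≤⟨ degree≤ (∁? (_≟ a) ∩? ∁? (_≟ b)) z-red greenAvoiding ⟩
      count (green? ∩? (∁? (_≟ a) ∩? ∁? (_≟ b)))  ≡⟨ greens∖₂≡4 a-green b-green a≢b ⟩
      4                                           ∎)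
      where open ≤-Reasoning

    ¬three-greens : ∀ {z l₀ u₁ u₂ u₃} → IsRed z → z ∈ L l₀ → GreenOn l₀ u₁ → GreenOn l₀ u₂ → GreenOn l₀ u₃ →
                    u₁ ≢ u₂ → u₁ ≢ u₃ → u₂ ≢ u₃ → ⊥
    ¬three-greens {z} {l₀} {u₁} {u₂} {u₃} z-red z∈l₀ (u₁-green , u₁∈l₀) (u₂-green , u₂∈l₀) (u₃-green , u₃∈l₀)
                  u₁≢u₂ u₁≢u₃ u₂≢u₃ = ¬lines-avoid-two-greens z-red u₂-green u₃-green u₂≢u₃ greenAvoiding
      where
      greenAvoiding : ∀ l → z ∈ L l → ∃[ g ] (IsGreen g × g ∈ L l × g ≢ u₂ × g ≢ u₃)
      greenAvoiding l z∈l with l ≟ l₀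
      ... | yes refl = u₁ , u₁-green , u₁∈l₀ , u₁≢u₂ , u₁≢u₃
      ... | no l≢l₀  = let g , g∈l , g-green = has-green l in
        g , g-green , g∈l , ≢-on-other-line z-red z∈l z∈l₀ l≢l₀ u₂-green u₂∈l₀ g∈l
                          , ≢-on-other-line z-red z∈l z∈l₀ l≢l₀ u₃-green u₃∈l₀ g∈l

    ¬two-secants : ∀ {z l₁ l₂ u₁ u₂ v₁ v₂} → IsRed z → l₁ ≢ l₂ → z ∈ L l₁ → z ∈ L l₂ →
                   GreenOn l₁ u₁ → GreenOn l₁ u₂ → GreenOn l₂ v₁ → GreenOn l₂ v₂ → u₁ ≢ u₂ → v₁ ≢ v₂ → ⊥
    ¬two-secants {z} {l₁} {l₂} {u₁} {u₂} {v₁} {v₂} z-red l₁≢l₂ z∈l₁ z∈l₂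
                 (u₁-green , u₁∈l₁) (u₂-green , u₂∈l₁) (v₁-green , v₁∈l₂) (v₂-green , v₂∈l₂) u₁≢u₂ v₁≢v₂ =
      ¬lines-avoid-two-greens z-red u₂-green v₂-green (≢-on-other-line z-red z∈l₁ z∈l₂ l₁≢l₂ v₂-green v₂∈l₂ u₂∈l₁)
        greenAvoiding
      where
      greenAvoiding : ∀ l → z ∈ L l → ∃[ g ] (IsGreen g × g ∈ L l × g ≢ u₂ × g ≢ v₂)
      greenAvoiding l z∈l with l ≟ l₁ | l ≟ l₂
      ... | yes refl | _ =
        u₁ , u₁-green , u₁∈l₁ , u₁≢u₂ , ≢-on-other-line z-red z∈l₁ z∈l₂ l₁≢l₂ v₂-green v₂∈l₂ u₁∈l₁
      ... | no l≢l₁ | yes refl =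
        v₁ , v₁-green , v₁∈l₂ , ≢-on-other-line z-red z∈l₂ z∈l₁ (l₁≢l₂ ∘ sym) u₂-green u₂∈l₁ v₁∈l₂ , v₁≢v₂
      ... | no l≢l₁ | no l≢l₂ = let g , g∈l , g-green = has-green l in
        g , g-green , g∈l , ≢-on-other-line z-red z∈l z∈l₁ l≢l₁ u₂-green u₂∈l₁ g∈l
                          , ≢-on-other-line z-red z∈l z∈l₂ l≢l₂ v₂-green v₂∈l₂ g∈l

    at-most-two-greens : ∀ {r g u u′} → IsRed r → IsGreen g → IsGreen u → IsGreen u′ → u ≢ g → u′ ≢ g →
                         Collinear g u r → Collinear g u′ r → u ≡ u′
    at-most-two-greens {u = u} {u′} r-red g-green u-green u′-green u≢g u′≢g
                       (l , g∈l , u∈l , r∈l) (l′ , g∈l′ , u′∈l′ , r∈l′) with u ≟ u′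
    ... | yes u≡u′ = u≡u′
    ... | no u≢u′  = ⊥-elim (¬three-greens r-red r∈l (g-green , g∈l) (u-green , u∈l) (u′-green , u′∈l)
                       (u≢g ∘ sym) (u′≢g ∘ sym) u≢u′)
      where
      u′∈l : u′ ∈ L l
      u′∈l = collinear⇒∈ (red≢green r-red g-green ∘ sym) g∈l r∈l (l′ , g∈l′ , r∈l′ , u′∈l′)

    Paired : Fin n → Fin n → Set
    Paired g z = IsRed z × IsGreen g × ∃[ u ] (IsGreen u × u ≢ g × Collinear z g u)

    paired? : ∀ g z → Dec (Paired g z)
    paired? g z = red? z ×-dec green? g ×-dec any? (λ u → green? u ×-dec ¬? (u ≟ g) ×-dec collinear? z g u)

    5≤row : ∀ g → (g-green? : Dec (IsGreen g)) → 5 * indicator g-green? ≤ count (paired? g)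
    5≤row g (no _) = z≤n
    5≤row g (yes g-green) = begin
      5                            ≡⟨ ℕ.suc-injective (trans (sym (count-remove green? g-green)) six) ⟨
      count (green? ∩? ∁? (_≟ g))  ≤⟨ count-injective (green? ∩? ∁? (_≟ g)) (paired? g) red∈join red∈join-paired
                                        red∈join-inj ⟩
      count (paired? g)            ∎
      where
      open ≤-Reasoning
      red∈join : ∀ u → (IsGreen ∩ ∁ (_≡ g)) u → Fin n
      red∈join u (_ , u≢g) = proj₁ (join-red (u≢g ∘ sym))
      red∈join-spec : ∀ u Gu → IsRed (red∈join u Gu) × Collinear g u (red∈join u Gu)
      red∈join-spec u (_ , u≢g) = proj₂ (join-red (u≢g ∘ sym))
      red∈join-paired : ∀ u Gu → Paired g (red∈join u Gu)
      red∈join-paired u Gu@(u-green , u≢g) with red∈join-spec u Gu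
      ... | r-red , l , g∈l , u∈l , r∈l = r-red , g-green , u , u-green , u≢g , l , r∈l , g∈l , u∈l
      red∈join-inj : ∀ u u′ Gu Gu′ → red∈join u Gu ≡ red∈join u′ Gu′ → u ≡ u′
      red∈join-inj u u′ Gu@(u-green , u≢g) Gu′@(u′-green , u′≢g) same =
        at-most-two-greens (proj₁ (red∈join-spec u Gu)) g-green u-green u′-green u≢g u′≢g
          (proj₂ (red∈join-spec u Gu)) (subst (Collinear g u′) (sym same) (proj₂ (red∈join-spec u′ Gu′)))

    column≤2 : ∀ z → (z-red? : Dec (IsRed z)) → count (λ g → paired? g z) ≤ 2 * indicator z-red?
    column≤2 z (no ¬red) = ≤-reflexive (count-∅ (λ g → paired? g z) (λ g (z-red , _) → ¬red z-red))
    column≤2 z (yes z-red) with any? (λ g → paired? g z)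
    ... | no none = ≤-trans (≤-reflexive (count-∅ (λ g → paired? g z) (λ g p → none (g , p)))) z≤n
    ... | yes (g₀ , _ , g₀-green , u₀ , u₀-green , u₀≢g₀ , l₀ , z∈l₀ , g₀∈l₀ , u₀∈l₀) =
      count≤2 (λ g → paired? g z) g₀-or-u₀
      where
      g₀-or-u₀ : ∀ {g} → Paired g z → g ≡ g₀ ⊎ g ≡ u₀
      g₀-or-u₀ {g} (_ , g-green , u , u-green , u≢g , l , z∈l , g∈l , u∈l) with l ≟ l₀
      ... | no l≢l₀ = ⊥-elim (¬two-secants z-red l≢l₀ z∈l z∈l₀ (g-green , g∈l) (u-green , u∈l)
                                (g₀-green , g₀∈l₀) (u₀-green , u₀∈l₀) (u≢g ∘ sym) (u₀≢g₀ ∘ sym))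
      ... | yes refl with g ≟ g₀ | g ≟ u₀
      ...   | yes g≡g₀ | _        = inj₁ g≡g₀
      ...   | no _     | yes g≡u₀ = inj₂ g≡u₀
      ...   | no g≢g₀  | no g≢u₀  = ⊥-elim (¬three-greens z-red z∈l₀ (g₀-green , g₀∈l₀) (u₀-green , u₀∈l₀)
                                      (g-green , g∈l) (u₀≢g₀ ∘ sym) (g≢g₀ ∘ sym) (g≢u₀ ∘ sym))

    reds≤13 : count red? ≤ 13
    reds≤13 = +-cancelʳ-≤ 6 _ 13 (begin
      count red? + 6             ≡⟨ cong (count red? +_) six ⟨
      count red? + count green?  ≡⟨ n≡reds+greens ⟨
      n                          ≤⟨ n≤1+s*degree size≤4 z ⟩
      suc (3 * degree z)         ≤⟨ s≤s (*-monoʳ-≤ 3 (degree≤6 z-red)) ⟩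
      19                         ∎)
      where
      open ≤-Reasoning
      0<reds : 0 < count red?
      0<reds = +-cancelʳ-≤ 6 1 _ (≤-trans (≤-trans (m≤m+n 7 7) 14≤n)
                                          (≤-reflexive (trans n≡reds+greens (cong (count red? +_) six))))
      z : Fin n
      z = proj₁ (count-witness red? 0<reds)
      z-red : IsRed z
      z-red = proj₂ (count-witness red? 0<reds)

    impossible : ⊥
    impossible = <-irrefl refl (begin-strict
      30                                     ≡⟨ cong (5 *_) six ⟨
      5 * count green?                       ≡⟨ ∑-* 5 (indicator ∘ green?) ⟨
      sum (λ g → 5 * indicator (green? g))   ≤⟨ ∑-mono-≤ (λ g → 5≤row g (green? g)) ⟩
      sum (λ g → count (paired? g))          ≡⟨ ∑-comm (λ g z → indicator (paired? g z)) ⟩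
      sum (λ z → count (λ g → paired? g z))  ≤⟨ ∑-mono-≤ (λ z → column≤2 z (red? z)) ⟩
      sum (λ z → 2 * indicator (red? z))     ≡⟨ ∑-* 2 (indicator ∘ red?) ⟩
      2 * count red?                         ≤⟨ *-monoʳ-≤ 2 reds≤13 ⟩
      26                                     <⟨ m<m+n 26 (s≤s z≤n) ⟩
      30                                     ∎)
      where open ≤-Reasoning

∣greenPoints∣≡greens : ∀ {n} (c : Fin n → Bool) → ∣ greenPoints c ∣ ≡ count (λ p → c p Bool.≟ Green)
∣greenPoints∣≡greens {zero}  c = refl
∣greenPoints∣≡greens {suc n} c with c zero
... | true  = ∣greenPoints∣≡greens (c ∘ suc)
... | false = cong suc (∣greenPoints∣≡greens (c ∘ suc))

proposition3p7 : ∀ (n m : ℕ) (L : Fin m → Subset n) (c : Fin n → Bool) →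
                 IsMRGeometry n m L c → ∣ greenPoints c ∣ ≡ 6 → n ≤ 13
proposition3p7 n m L c mr six with n ≤? 13
... | yes n≤13 = n≤13
... | no n≰13  = ⊥-elim (SixGreens.ManyPoints.impossible mr six′ (≰⇒> n≰13))
  where
  six′ : count (MRGeometry.green? mr) ≡ 6
  six′ = trans (sym (∣greenPoints∣≡greens c)) six
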